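{- Let $t\in\mathbb{N}$ and let $x_1,\dots,x_t\in\{0,1\}^{2n}$ be such that every atom of the Boolean algebra of subsets of $[2n]$ generated by $\mathrm{supp}(x_1),\dots,\mathrm{supp}(x_t)$ has at least $n/2^{t+1}$ elements. Then for every choice of integers $(n_z)_{z\in\mathrm{Span}(x_1,\dots,x_t)}$, \[ \Pr_{x}\big[|x\oplus z|=n_z\text{ for all }z\in\mathrm{Span}(x_1,\dots,x_t)\big]\leq C_t\, n^{ -2^{t-1}}, \] where $x$ is uniform in $\{0,1\}^{2n}$ and $C_t$ is a constant depending only on $t$.
   Context: $|y|$ denotes Hamming weight, $\oplus$ coordinatewise addition mod 2, $\mathrm{supp}(y)=\{i: y_i=1\}$, and $\mathrm{Span}(x_1,\dots,x_t)$ is the $\mathbb{F}_2$-linear span in $\{0,1\}^{2n}=\mathbb{F}_2^{2n}$. The atoms of the algebra are the $2^t$ sets $\bigcap_{i=1}^t A_i$ with each $A_i\in\{\mathrm{supp}(x_i),[2n]\setminus\mathrm{supp}(x_i)\}$. -}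

module Defs where

open import Data.Nat using (ℕ; zero; suc)
open import Data.Bool using (Bool; true; false; _xor_; _∧_; if_then_else_)
open import Data.Bool.Properties using () renaming (_≟_ to _≟B_)
open import Data.Fin using (Fin)
open import Data.List as L using (List; []; _∷_; concatMap; filterᵇ; length; allFin)
open import Data.Vec as V using (Vec; []; _∷_; lookup; zipWith; replicate; countᵇ)
open import Data.Integer using (ℤ; +_)
open import Data.Integer.Properties using () renaming (_≟_ to _≟ℤ_)
open import Relation.Nullary.Decidable using (⌊_⌋)
open import Function using (id)
open import Data.Bool.ListAction using (and)

allVecs : (m : ℕ) → List (Vec Bool m)
allVecs zero = [] ∷ []
allVecs (suc m) = concatMap (λ v → (false ∷ v) ∷ (true ∷ v) ∷ []) (allVecs m)

weight : ∀ {m} → Vec Bool m → ℕ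
weight = countᵇ id

_⊕_ : ∀ {m} → Vec Bool m → Vec Bool m → Vec Bool m
_⊕_ = zipWith _xor_

-- the linear combination  c_1 x_1 ⊕ ... ⊕ c_t x_t ; these are exactly the
-- elements of Span(x_1,...,x_t) as c ranges over {0,1}^t
lin : ∀ {m t} → Vec (Vec Bool m) t → Vec Bool t → Vec Bool m
lin {m} [] [] = replicate m false
lin (x ∷ xs) (c ∷ cs) = (if c then x else replicate _ false) ⊕ lin xs cs

-- size of the atom ⋂_i A_i, where A_i = supp(x_i) if s_i = true and
-- A_i = [m] \ supp(x_i) if s_i = false
atomSize : ∀ {m t} → Vec (Vec Bool m) t → Vec Bool t → ℕ
atomSize {m} xs s =
  length (filterᵇ (λ j → V.foldr _ _∧_ true
                     (zipWith (λ x si → ⌊ lookup x j ≟B si ⌋) xs s))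
                  (allFin m))

allWeightsMatch : ∀ {m t} → Vec (Vec Bool m) t → (Vec Bool m → ℤ) → Vec Bool m → Bool
allWeightsMatch {t = t} xs nz x =
  and (L.map (λ c → ⌊ + weight (x ⊕ lin xs c) ≟ℤ nz (lin xs c) ⌋) (allVecs t))

eventCount : ∀ {m t} → Vec (Vec Bool m) t → (Vec Bool m → ℤ) → ℕ
eventCount {m} xs nz = length (filterᵇ (allWeightsMatch xs nz) (allVecs m))

-- Every x in the event has the same distances |x ⊕ z| to all z ∈ Span(x₁,…,x_t) as any fixed
-- element y of the event, so it suffices to bound the size N of the distance class of y.
-- Split the coordinates into supp(x₁) and its complement. The distances from x to z and to
-- x₁ ⊕ z differ only on supp(x₁), where they add up to |supp(x₁)|; so together they determine
-- the distances of both restrictions of x to the restrictions of z. Hence N ≤ N₁ N₀, where N_b is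
-- the distance class of a restriction of y relative to the restrictions of x₂,…,x_t, whose atoms
-- are atoms of the original algebra. Induction on t gives N² n^(2^t) ≤ K^(2^t) 4^m when every
-- atom has at least n/K of the m coordinates. For t = 0 the class consists of the vectors of
-- weight |y|, and binom(m,k)² m ≤ 4^m follows from binom(2n,n)² (3n+1) ≤ 16ⁿ, the strengthening
-- of binom(2n,n) ≤ 4ⁿ that survives induction.

module Submission where

open import Defs
open import Data.Bool using (Bool; true; false; T; _∧_; _xor_; if_then_else_)
open import Data.Bool.ListAction using (all)
open import Data.Bool.Properties using (T-∧; xor-identityˡ; xor-identityʳ) renaming (_≟_ to _≟B_)
open import Data.Empty using (⊥-elim)
open import Data.Fin using (Fin; zero; suc)
open import Data.Integer as ℤ using (ℤ)
open import Data.Integer.Properties using (+-injective)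
open import Data.List as L using (List; []; _∷_; length; filterᵇ; concatMap)
open import Data.List.Properties using (length-tabulate)
open import Data.List.Membership.Propositional using (_∈_)
open import Data.List.Membership.Propositional.Properties using (∈-concatMap⁺)
open import Data.List.Relation.Unary.All as All using ()
open import Data.List.Relation.Unary.All.Properties using (all⁺; all⁻)
open import Data.List.Relation.Unary.Any as Any using (here; there)
open import Data.Nat
open import Data.Nat.Combinatorics using (_C_; nC1≡n; nCk≡nC[n∸k]; nCk+nC[k+1]≡[n+1]C[k+1])
open import Data.Nat.Properties
open import Data.Nat.Tactic.RingSolver using (solve-∀)
open import Data.Product using (∃; _×_; _,_; proj₁; proj₂)
open import Data.Sum using (_⊎_; inj₁; inj₂)
open import Data.Vec as V using (Vec; []; _∷_; replicate; lookup)
open import Data.Vec.Properties using (zipWith-identityˡ; zipWith-identityʳ)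
open import Function using (_∘_; _⇔_; mk⇔; Equivalence)
open import Relation.Binary.PropositionalEquality
open import Relation.Nullary.Decidable using (⌊_⌋; toWitness; fromWitness)

count : {A : Set} → (A → Bool) → List A → ℕ
count P []       = 0
count P (x ∷ xs) = if P x then suc (count P xs) else count P xs

length-filterᵇ : {A : Set} (P : A → Bool) (xs : List A) → length (filterᵇ P xs) ≡ count P xs
length-filterᵇ P [] = refl
length-filterᵇ P (x ∷ xs) with P x
... | true  = cong suc (length-filterᵇ P xs)
... | false = length-filterᵇ P xs

count-mono : {A : Set} (P Q : A → Bool) (xs : List A) →
             (∀ x → T (P x) → T (Q x)) → count P xs ≤ count Q xs
count-mono P Q [] P⇒Q = z≤n
count-mono P Q (x ∷ xs) P⇒Q with P x in Px | Q x in Qx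
... | true  | true  = s≤s (count-mono P Q xs P⇒Q)
... | true  | false = ⊥-elim (subst T Qx (P⇒Q x (subst T (sym Px) _)))
... | false | true  = m≤n⇒m≤1+n (count-mono P Q xs P⇒Q)
... | false | false = count-mono P Q xs P⇒Q

count≡0⊎satisfiable : {A : Set} (P : A → Bool) (xs : List A) →
                      count P xs ≡ 0 ⊎ ∃ λ x → T (P x)
count≡0⊎satisfiable P [] = inj₁ refl
count≡0⊎satisfiable P (x ∷ xs) with P x in Px
... | true  = inj₂ (x , subst T (sym Px) _)
... | false = count≡0⊎satisfiable P xs

count-false : {A : Set} (xs : List A) → count (λ _ → false) xs ≡ 0
count-false []       = refl
count-false (x ∷ xs) = count-false xs

count-true : {A : Set} (xs : List A) → count (λ _ → true) xs ≡ length xs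
count-true []       = refl
count-true (x ∷ xs) = cong suc (count-true xs)

count-allVecs-suc : ∀ m (P : Vec Bool (suc m) → Bool) →
  count P (allVecs (suc m)) ≡ count (P ∘ (false ∷_)) (allVecs m) + count (P ∘ (true ∷_)) (allVecs m)
count-allVecs-suc m P = go (allVecs m)
  where
  go : ∀ vs → count P (concatMap (λ v → (false ∷ v) ∷ (true ∷ v) ∷ []) vs)
              ≡ count (P ∘ (false ∷_)) vs + count (P ∘ (true ∷_)) vs
  go [] = refl
  go (v ∷ vs) with P (false ∷ v) | P (true ∷ v)
  ... | true  | true  = cong suc (trans (cong suc (go vs)) (sym (+-suc _ _)))
  ... | true  | false = cong suc (go vs)
  ... | false | true  = trans (cong suc (go vs)) (sym (+-suc _ _))
  ... | false | false = go vs

∈-allVecs : ∀ {t} (c : Vec Bool t) → c ∈ allVecs t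
∈-allVecs []          = here refl
∈-allVecs (false ∷ c) = ∈-concatMap⁺ _ (Any.map (λ { refl → here refl }) (∈-allVecs c))
∈-allVecs (true ∷ c)  = ∈-concatMap⁺ _ (Any.map (λ { refl → there (here refl) }) (∈-allVecs c))

T-all-allVecs : ∀ {t} (f : Vec Bool t → Bool) → T (all f (allVecs t)) ⇔ (∀ c → T (f c))
T-all-allVecs f = mk⇔ (λ h c → All.lookup (all⁺ f _ h) (∈-allVecs c))
                      (λ h → all⁻ f {allVecs _} (All.tabulate (λ {c} _ → h c)))

-- Binomial coefficients

count-weight : ∀ m k → count (λ x → weight x ≡ᵇ k) (allVecs m) ≡ m C k
count-weight zero    zero    = refl
count-weight zero    (suc k) = refl
count-weight (suc m) zero    =
  trans (count-allVecs-suc m (λ x → weight x ≡ᵇ 0))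
        (cong₂ _+_ (count-weight m zero) (count-false (allVecs m)))
count-weight (suc m) (suc k) =
  trans (count-allVecs-suc m (λ x → weight x ≡ᵇ suc k))
        (trans (cong₂ _+_ (count-weight m (suc k)) (count-weight m k))
               (trans (+-comm (m C suc k) (m C k)) (nCk+nC[k+1]≡[n+1]C[k+1] m k)))

[k+1]*[m+1]C[k+1]≡[m+1]*mCk : ∀ m k → suc k * (suc m C suc k) ≡ suc m * (m C k)
[k+1]*[m+1]C[k+1]≡[m+1]*mCk m       zero    = trans (*-identityˡ _) (trans (nC1≡n (suc m)) (sym (*-identityʳ (suc m))))
[k+1]*[m+1]C[k+1]≡[m+1]*mCk zero    (suc k) = *-zeroʳ (suc (suc k))
[k+1]*[m+1]C[k+1]≡[m+1]*mCk (suc m) (suc k) = begin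
  suc (suc k) * (suc (suc m) C suc (suc k))
    ≡⟨ cong (suc (suc k) *_) (nCk+nC[k+1]≡[n+1]C[k+1] (suc m) (suc k)) ⟨
  suc (suc k) * (suc m C suc k + suc m C suc (suc k))
    ≡⟨ *-distribˡ-+ (suc (suc k)) (suc m C suc k) _ ⟩
  (suc m C suc k + suc k * (suc m C suc k)) + suc (suc k) * (suc m C suc (suc k))
    ≡⟨ cong₂ (λ a b → suc m C suc k + a + b) ([k+1]*[m+1]C[k+1]≡[m+1]*mCk m k) ([k+1]*[m+1]C[k+1]≡[m+1]*mCk m (suc k)) ⟩
  (suc m C suc k + suc m * (m C k)) + suc m * (m C suc k)
    ≡⟨ +-assoc (suc m C suc k) _ _ ⟩
  suc m C suc k + (suc m * (m C k) + suc m * (m C suc k))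
    ≡⟨ cong ((suc m C suc k) +_) (*-distribˡ-+ (suc m) (m C k) _) ⟨
  suc m C suc k + suc m * (m C k + m C suc k)
    ≡⟨ cong (λ a → suc m C suc k + suc m * a) (nCk+nC[k+1]≡[n+1]C[k+1] m k) ⟩
  suc (suc m) * (suc m C suc k) ∎
  where open ≡-Reasoning

[k+1]*mC[k+1]+[k+1]*mCk≡[m+1]*mCk : ∀ m k → suc k * (m C suc k) + suc k * (m C k) ≡ suc m * (m C k)
[k+1]*mC[k+1]+[k+1]*mCk≡[m+1]*mCk m k = begin
  suc k * (m C suc k) + suc k * (m C k) ≡⟨ *-distribˡ-+ (suc k) (m C suc k) (m C k) ⟨
  suc k * (m C suc k + m C k)           ≡⟨ cong (suc k *_) (+-comm (m C suc k) (m C k)) ⟩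
  suc k * (m C k + m C suc k)           ≡⟨ cong (suc k *_) (nCk+nC[k+1]≡[n+1]C[k+1] m k) ⟩
  suc k * (suc m C suc k)               ≡⟨ [k+1]*[m+1]C[k+1]≡[m+1]*mCk m k ⟩
  suc m * (m C k)                       ∎
  where open ≡-Reasoning

unimodal⇒≤peak : (f : ℕ → ℕ) (n : ℕ) →
                 (∀ k → k < n → f k ≤ f (suc k)) → (∀ k → n ≤ k → f (suc k) ≤ f k) →
                 ∀ k → f k ≤ f n
unimodal⇒≤peak f n rising falling k with ≤-total k n
... | inj₁ k≤n = ascend (n ∸ k) k (m+[n∸m]≡n k≤n)
  where
  ascend : ∀ d k → k + d ≡ n → f k ≤ f n
  ascend zero    k k+0≡n  = ≤-reflexive (cong f (trans (sym (+-identityʳ k)) k+0≡n))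
  ascend (suc d) k k+1+d≡n = ≤-trans (rising k (subst (k <_) k+1+d≡n (m<m+n k z<s)))
                                     (ascend d (suc k) (trans (sym (+-suc k d)) k+1+d≡n))
... | inj₂ n≤k = subst (λ j → f j ≤ f n) (m+[n∸m]≡n n≤k) (descend (k ∸ n))
  where
  descend : ∀ d → f (n + d) ≤ f n
  descend zero    = ≤-reflexive (cong f (+-identityʳ n))
  descend (suc d) = ≤-trans (subst (λ j → f j ≤ f (n + d)) (sym (+-suc n d)) (falling (n + d) (m≤m+n n d)))
                            (descend d)

[2n]Ck≤[2n]Cn : ∀ n k → (n + n) C k ≤ (n + n) C n
[2n]Ck≤[2n]Cn n = unimodal⇒≤peak ((n + n) C_) n rising falling
  where
  ratio : ∀ k → suc k * ((n + n) C suc k) + suc k * ((n + n) C k) ≡ suc (n + n) * ((n + n) C k)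
  ratio = [k+1]*mC[k+1]+[k+1]*mCk≡[m+1]*mCk (n + n)
  rising : ∀ k → k < n → (n + n) C k ≤ (n + n) C suc k
  rising k k<n = *-cancelˡ-≤ (suc k) (+-cancelʳ-≤ (suc k * ((n + n) C k)) _ _ (begin
    suc k * ((n + n) C k) + suc k * ((n + n) C k) ≡⟨ *-distribʳ-+ ((n + n) C k) (suc k) (suc k) ⟨
    (suc k + suc k) * ((n + n) C k)              ≤⟨ *-monoˡ-≤ ((n + n) C k) (s≤s (+-mono-≤ (<⇒≤ k<n) k<n)) ⟩
    suc (n + n) * ((n + n) C k)                  ≡⟨ ratio k ⟨
    suc k * ((n + n) C suc k) + suc k * ((n + n) C k) ∎))
    where open ≤-Reasoning
  falling : ∀ k → n ≤ k → (n + n) C suc k ≤ (n + n) C k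
  falling k n≤k = *-cancelˡ-≤ (suc k) (+-cancelʳ-≤ (suc k * ((n + n) C k)) _ _ (begin
    suc k * ((n + n) C suc k) + suc k * ((n + n) C k) ≡⟨ ratio k ⟩
    suc (n + n) * ((n + n) C k)                  ≤⟨ *-monoˡ-≤ ((n + n) C k) (s≤s (+-mono-≤ n≤k (m≤n⇒m≤1+n n≤k))) ⟩
    (suc k + suc k) * ((n + n) C k)              ≡⟨ *-distribʳ-+ ((n + n) C k) (suc k) (suc k) ⟩
    suc k * ((n + n) C k) + suc k * ((n + n) C k) ∎))
    where open ≤-Reasoning

[n+1]*[2n+2]C[n+1]≡2*[2n+1]*[2n]Cn : ∀ n → suc n * ((suc n + suc n) C suc n) ≡ 2 * (suc (n + n) * ((n + n) C n))
[n+1]*[2n+2]C[n+1]≡2*[2n+1]*[2n]Cn n = begin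
  suc n * ((suc n + suc n) C suc n)          ≡⟨ cong (λ m → suc n * (suc m C suc n)) (+-suc n n) ⟩
  suc n * (suc (suc (n + n)) C suc n)        ≡⟨ cong (suc n *_) (nCk+nC[k+1]≡[n+1]C[k+1] (suc (n + n)) n) ⟨
  suc n * (suc (n + n) C n + X)              ≡⟨ cong (λ a → suc n * (a + X)) middle-symmetric ⟩
  suc n * (X + X)                            ≡⟨ *-distribˡ-+ (suc n) X X ⟩
  suc n * X + suc n * X                      ≡⟨ cong (λ a → a + a) ([k+1]*[m+1]C[k+1]≡[m+1]*mCk (n + n) n) ⟩
  Y + Y                                      ≡⟨ cong (Y +_) (+-identityʳ Y) ⟨
  2 * Y                                      ∎
  where
  open ≡-Reasoning
  X Y : ℕ
  X = suc (n + n) C suc n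
  Y = suc (n + n) * ((n + n) C n)
  middle-symmetric : suc (n + n) C n ≡ X
  middle-symmetric = begin
    suc (n + n) C n                         ≡⟨ cong (suc (n + n) C_) (m+n∸n≡m n n) ⟨
    suc (n + n) C (suc (n + n) ∸ suc n)     ≡⟨ nCk≡nC[n∸k] (s≤s (m≤m+n n n)) ⟨
    X                                       ∎

[2n+1]²[3n+4]≤4[n+1]²[3n+1] : ∀ n → suc (n + n) * suc (n + n) * (3 * n + 4) ≤ 4 * (suc n * suc n) * suc (3 * n)
[2n+1]²[3n+4]≤4[n+1]²[3n+1] n = subst (suc (n + n) * suc (n + n) * (3 * n + 4) ≤_) (identity n) (m≤m+n _ n)
  where
  identity : ∀ n → suc (n + n) * suc (n + n) * (3 * n + 4) + n ≡ 4 * (suc n * suc n) * suc (3 * n)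
  identity = solve-∀

[2n]Cn²*[3n+1]≤16^n : ∀ n → ((n + n) C n) * ((n + n) C n) * suc (3 * n) ≤ 16 ^ n
[2n]Cn²*[3n+1]≤16^n zero    = ≤-refl
[2n]Cn²*[3n+1]≤16^n (suc n) = *-cancelˡ-≤ (suc n * suc n) (begin
  suc n * suc n * (c′ * c′ * suc (3 * suc n))
    ≡⟨ regroup₁ n c′ ⟩
  (suc n * c′) * (suc n * c′) * (3 * n + 4)
    ≡⟨ cong (λ a → a * a * (3 * n + 4)) ([n+1]*[2n+2]C[n+1]≡2*[2n+1]*[2n]Cn n) ⟩
  2 * (suc (n + n) * c) * (2 * (suc (n + n) * c)) * (3 * n + 4)
    ≡⟨ regroup₂ n c ⟩
  4 * (c * c) * (suc (n + n) * suc (n + n) * (3 * n + 4))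
    ≤⟨ *-monoʳ-≤ (4 * (c * c)) ([2n+1]²[3n+4]≤4[n+1]²[3n+1] n) ⟩
  4 * (c * c) * (4 * (suc n * suc n) * suc (3 * n))
    ≡⟨ regroup₃ n c ⟩
  suc n * suc n * (16 * (c * c * suc (3 * n)))
    ≤⟨ *-monoʳ-≤ (suc n * suc n) (*-monoʳ-≤ 16 ([2n]Cn²*[3n+1]≤16^n n)) ⟩
  suc n * suc n * 16 ^ suc n ∎)
  where
  open ≤-Reasoning
  c c′ : ℕ
  c  = (n + n) C n
  c′ = (suc n + suc n) C suc n
  regroup₁ : ∀ n c′ → suc n * suc n * (c′ * c′ * suc (3 * suc n)) ≡ (suc n * c′) * (suc n * c′) * (3 * n + 4)
  regroup₁ = solve-∀
  regroup₂ : ∀ n c → 2 * (suc (n + n) * c) * (2 * (suc (n + n) * c)) * (3 * n + 4)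
                     ≡ 4 * (c * c) * (suc (n + n) * suc (n + n) * (3 * n + 4))
  regroup₂ = solve-∀
  regroup₃ : ∀ n c → 4 * (c * c) * (4 * (suc n * suc n) * suc (3 * n)) ≡ suc n * suc n * (16 * (c * c * suc (3 * n)))
  regroup₃ = solve-∀

data Halving : ℕ → Set where
  even : ∀ n → Halving (n + n)
  odd  : ∀ n → Halving (suc (n + n))

halving : ∀ m → Halving m
halving zero = even zero
halving (suc m) with halving m
... | even n = odd n
... | odd n  = subst Halving (cong suc (+-suc n n)) (even (suc n))

16^n≡4^[n+n] : ∀ n → 16 ^ n ≡ 4 ^ (n + n)
16^n≡4^[n+n] n = trans (^-*-assoc 4 2 n) (cong (λ k → 4 ^ (n + k)) (+-identityʳ n))

n+n≤3n : ∀ n → n + n ≤ 3 * n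
n+n≤3n n = +-monoʳ-≤ n (m≤m+n n (n + 0))

mCk²*m≤4^m : ∀ m k → (m C k) * (m C k) * m ≤ 4 ^ m
mCk²*m≤4^m m k with halving m
... | even n = begin
  ((n + n) C k) * ((n + n) C k) * (n + n) ≤⟨ *-mono-≤ (*-mono-≤ c-max c-max) (m≤n⇒m≤1+n (n+n≤3n n)) ⟩
  c * c * suc (3 * n)                     ≤⟨ [2n]Cn²*[3n+1]≤16^n n ⟩
  16 ^ n                                  ≡⟨ 16^n≡4^[n+n] n ⟩
  4 ^ (n + n)                             ∎
  where
  open ≤-Reasoning
  c : ℕ
  c = (n + n) C n
  c-max : (n + n) C k ≤ c
  c-max = [2n]Ck≤[2n]Cn n k
... | odd n = begin
  b * b * suc (n + n)       ≤⟨ *-mono-≤ (*-mono-≤ (b≤2c k) (b≤2c k)) (s≤s (n+n≤3n n)) ⟩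
  2 * c * (2 * c) * suc (3 * n) ≡⟨ regroup c (suc (3 * n)) ⟩
  4 * (c * c * suc (3 * n)) ≤⟨ *-monoʳ-≤ 4 ([2n]Cn²*[3n+1]≤16^n n) ⟩
  4 * 16 ^ n                ≡⟨ cong (4 *_) (16^n≡4^[n+n] n) ⟩
  4 ^ suc (n + n)           ∎
  where
  open ≤-Reasoning
  b c : ℕ
  b = suc (n + n) C k
  c = (n + n) C n
  b≤2c : ∀ k → suc (n + n) C k ≤ 2 * c
  b≤2c zero    = ≤-trans ([2n]Ck≤[2n]Cn n 0) (m≤m+n c (c + 0))
  b≤2c (suc k) = begin
    suc (n + n) C suc k           ≡⟨ nCk+nC[k+1]≡[n+1]C[k+1] (n + n) k ⟨
    (n + n) C k + (n + n) C suc k ≤⟨ +-mono-≤ ([2n]Ck≤[2n]Cn n k) ([2n]Ck≤[2n]Cn n (suc k)) ⟩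
    c + c                         ≡⟨ cong (c +_) (+-identityʳ c) ⟨
    2 * c                         ∎
  regroup : ∀ c a → 2 * c * (2 * c) * a ≡ 4 * (c * c * a)
  regroup = solve-∀

-- Restriction to the coordinates where a vector takes a given value

occ : ∀ {m} → Bool → Vec Bool m → ℕ
occ b [] = 0
occ true  (true  ∷ S) = suc (occ true S)
occ true  (false ∷ S) = occ true S
occ false (true  ∷ S) = occ false S
occ false (false ∷ S) = suc (occ false S)

select : ∀ {m} {A : Set} (b : Bool) (S : Vec Bool m) → Vec A m → Vec A (occ b S)
select b [] [] = []
select true  (true  ∷ S) (a ∷ x) = a ∷ select true S x
select true  (false ∷ S) (a ∷ x) = select true S x
select false (true  ∷ S) (a ∷ x) = select false S x
select false (false ∷ S) (a ∷ x) = a ∷ select false S x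

occ-true+occ-false : ∀ {m} (S : Vec Bool m) → occ true S + occ false S ≡ m
occ-true+occ-false [] = refl
occ-true+occ-false (true  ∷ S) = cong suc (occ-true+occ-false S)
occ-true+occ-false (false ∷ S) = trans (+-suc _ _) (cong suc (occ-true+occ-false S))

select-zipWith : ∀ {m} {A B C : Set} (f : A → B → C) b (S : Vec Bool m) u v →
                 select b S (V.zipWith f u v) ≡ V.zipWith f (select b S u) (select b S v)
select-zipWith f b [] [] [] = refl
select-zipWith f true  (true  ∷ S) (a ∷ u) (c ∷ v) = cong (f a c ∷_) (select-zipWith f true S u v)
select-zipWith f true  (false ∷ S) (a ∷ u) (c ∷ v) = select-zipWith f true S u v
select-zipWith f false (true  ∷ S) (a ∷ u) (c ∷ v) = select-zipWith f false S u v
select-zipWith f false (false ∷ S) (a ∷ u) (c ∷ v) = cong (f a c ∷_) (select-zipWith f false S u v)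

select-replicate : ∀ {m} {A : Set} b (S : Vec Bool m) (a : A) → select b S (replicate m a) ≡ replicate (occ b S) a
select-replicate b [] a = refl
select-replicate true  (true  ∷ S) a = cong (a ∷_) (select-replicate true S a)
select-replicate true  (false ∷ S) a = select-replicate true S a
select-replicate false (true  ∷ S) a = select-replicate false S a
select-replicate false (false ∷ S) a = cong (a ∷_) (select-replicate false S a)

select-self : ∀ {m} b (S : Vec Bool m) → select b S S ≡ replicate (occ b S) b
select-self b [] = refl
select-self true  (true  ∷ S) = cong (true ∷_) (select-self true S)
select-self true  (false ∷ S) = select-self true S
select-self false (true  ∷ S) = select-self false S
select-self false (false ∷ S) = cong (false ∷_) (select-self false S)

weight-select : ∀ {m} (S : Vec Bool m) v → weight v ≡ weight (select true S v) + weight (select false S v)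
weight-select [] [] = refl
weight-select (true  ∷ S) (true  ∷ v) = cong suc (weight-select S v)
weight-select (true  ∷ S) (false ∷ v) = weight-select S v
weight-select (false ∷ S) (true  ∷ v) = trans (cong suc (weight-select S v)) (sym (+-suc _ _))
weight-select (false ∷ S) (false ∷ v) = weight-select S v

select-lin : ∀ {m t} b (S : Vec Bool m) (xs : Vec (Vec Bool m) t) c →
             lin (V.map (select b S) xs) c ≡ select b S (lin xs c)
select-lin b S [] [] = sym (select-replicate b S false)
select-lin b S (x ∷ xs) (c ∷ cs) = begin
  lin (V.map (select b S) (x ∷ xs)) (c ∷ cs)                        ≡⟨ cong₂ _⊕_ (chosen c) (select-lin b S xs cs) ⟩
  select b S (if c then x else replicate _ false) ⊕ select b S (lin xs cs) ≡⟨ select-zipWith _xor_ b S _ _ ⟨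
  select b S (lin (x ∷ xs) (c ∷ cs))                                ∎
  where
  open ≡-Reasoning
  chosen : ∀ c → (if c then select b S x else replicate _ false) ≡ select b S (if c then x else replicate _ false)
  chosen true  = refl
  chosen false = sym (select-replicate b S false)

count-select : ∀ {m} (S : Vec Bool m) (P : Vec Bool (occ true S) → Bool) (Q : Vec Bool (occ false S) → Bool) →
  count (λ x → P (select true S x) ∧ Q (select false S x)) (allVecs m)
  ≡ count P (allVecs (occ true S)) * count Q (allVecs (occ false S))
count-select [] P Q with P [] | Q []
... | true  | true  = refl
... | true  | false = refl
... | false | _     = refl
count-select {suc m} (true ∷ S) P Q = begin
  count (λ x → P (select true (true ∷ S) x) ∧ Q (select false (true ∷ S) x)) (allVecs (suc m))
    ≡⟨ trans (count-allVecs-suc m _) (cong₂ _+_ (count-select S (P ∘ (false ∷_)) Q) (count-select S (P ∘ (true ∷_)) Q)) ⟩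
  #T (P ∘ (false ∷_)) * #F Q + #T (P ∘ (true ∷_)) * #F Q
    ≡⟨ *-distribʳ-+ (#F Q) (#T (P ∘ (false ∷_))) _ ⟨
  (#T (P ∘ (false ∷_)) + #T (P ∘ (true ∷_))) * #F Q
    ≡⟨ cong (_* #F Q) (count-allVecs-suc (occ true S) P) ⟨
  count P (allVecs (suc (occ true S))) * #F Q ∎
  where
  open ≡-Reasoning
  #T : (Vec Bool (occ true S) → Bool) → ℕ
  #T P = count P (allVecs (occ true S))
  #F : (Vec Bool (occ false S) → Bool) → ℕ
  #F Q = count Q (allVecs (occ false S))
count-select {suc m} (false ∷ S) P Q = begin
  count (λ x → P (select true (false ∷ S) x) ∧ Q (select false (false ∷ S) x)) (allVecs (suc m))
    ≡⟨ trans (count-allVecs-suc m _) (cong₂ _+_ (count-select S P (Q ∘ (false ∷_))) (count-select S P (Q ∘ (true ∷_)))) ⟩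
  #T P * #F (Q ∘ (false ∷_)) + #T P * #F (Q ∘ (true ∷_))
    ≡⟨ *-distribˡ-+ (#T P) (#F (Q ∘ (false ∷_))) _ ⟨
  #T P * (#F (Q ∘ (false ∷_)) + #F (Q ∘ (true ∷_)))
    ≡⟨ cong (#T P *_) (count-allVecs-suc (occ false S) Q) ⟨
  #T P * count Q (allVecs (suc (occ false S))) ∎
  where
  open ≡-Reasoning
  #T : (Vec Bool (occ true S) → Bool) → ℕ
  #T P = count P (allVecs (occ true S))
  #F : (Vec Bool (occ false S) → Bool) → ℕ
  #F Q = count Q (allVecs (occ false S))

-- Atoms

inAtom : ∀ {m t} → Vec (Vec Bool m) t → Vec Bool t → Fin m → Bool
inAtom xs s j = V.foldr _ _∧_ true (V.zipWith (λ x sᵢ → ⌊ lookup x j ≟B sᵢ ⌋) xs s)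

inAtom-suc : ∀ {m t} (xs : Vec (Vec Bool (suc m)) t) s j → inAtom xs s (suc j) ≡ inAtom (V.map V.tail xs) s j
inAtom-suc [] [] j = refl
inAtom-suc ((a ∷ x) ∷ xs) (b ∷ s) j = cong (⌊ lookup x j ≟B b ⌋ ∧_) (inAtom-suc xs s j)

count-tabulate-cong : ∀ {n} {A B : Set} (P : A → Bool) (Q : B → Bool) (f : Fin n → A) (g : Fin n → B) →
                      (∀ i → P (f i) ≡ Q (g i)) → count P (L.tabulate f) ≡ count Q (L.tabulate g)
count-tabulate-cong {zero}  P Q f g P∘f≗Q∘g = refl
count-tabulate-cong {suc n} P Q f g P∘f≗Q∘g
  rewrite P∘f≗Q∘g zero | count-tabulate-cong P Q (f ∘ suc) (g ∘ suc) (P∘f≗Q∘g ∘ suc) = refl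

atomSize-suc : ∀ {m t} (xs : Vec (Vec Bool (suc m)) t) s →
  atomSize xs s ≡ (if inAtom xs s zero then suc (atomSize (V.map V.tail xs) s) else atomSize (V.map V.tail xs) s)
atomSize-suc {m} xs s = begin
  atomSize xs s                                          ≡⟨ length-filterᵇ (inAtom xs s) (L.allFin (suc m)) ⟩
  count (inAtom xs s) (zero ∷ L.tabulate suc)            ≡⟨ cong (λ k → if inAtom xs s zero then suc k else k) rest ⟩
  (if inAtom xs s zero then suc tailSize else tailSize)  ∎
  where
  open ≡-Reasoning
  tailSize : ℕ
  tailSize = atomSize (V.map V.tail xs) s
  rest : count (inAtom xs s) (L.tabulate suc) ≡ tailSize
  rest = trans (count-tabulate-cong _ _ suc (λ j → j) (inAtom-suc xs s))
               (sym (length-filterᵇ (inAtom (V.map V.tail xs) s) (L.allFin m)))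

atomSize-[] : ∀ m → atomSize {m} [] [] ≡ m
atomSize-[] m = trans (length-filterᵇ _ (L.allFin m)) (trans (count-true (L.allFin m)) (length-tabulate (λ j → j)))

module _ {m} (r : Vec Bool m) where

  inAtom-zero-select-true : ∀ {t} (xs : Vec (Vec Bool (suc m)) t) (s : Vec Bool t) →
                            inAtom (V.map (select true (true ∷ r)) xs) s zero ≡ inAtom xs s zero
  inAtom-zero-select-true [] [] = refl
  inAtom-zero-select-true ((a ∷ x) ∷ xs) (b ∷ s) = cong (⌊ a ≟B b ⌋ ∧_) (inAtom-zero-select-true xs s)

  inAtom-zero-select-false : ∀ {t} (xs : Vec (Vec Bool (suc m)) t) (s : Vec Bool t) →
                             inAtom (V.map (select false (false ∷ r)) xs) s zero ≡ inAtom xs s zero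
  inAtom-zero-select-false [] [] = refl
  inAtom-zero-select-false ((a ∷ x) ∷ xs) (b ∷ s) = cong (⌊ a ≟B b ⌋ ∧_) (inAtom-zero-select-false xs s)

  tail-select-true : ∀ {t} (xs : Vec (Vec Bool (suc m)) t) →
                     V.map V.tail (V.map (select true (true ∷ r)) xs) ≡ V.map (select true r) (V.map V.tail xs)
  tail-select-true [] = refl
  tail-select-true ((a ∷ x) ∷ xs) = cong (select true r x ∷_) (tail-select-true xs)

  tail-select-false : ∀ {t} (xs : Vec (Vec Bool (suc m)) t) →
                      V.map V.tail (V.map (select false (false ∷ r)) xs) ≡ V.map (select false r) (V.map V.tail xs)
  tail-select-false [] = refl
  tail-select-false ((a ∷ x) ∷ xs) = cong (select false r x ∷_) (tail-select-false xs)

  select-skip-true : ∀ {t} (xs : Vec (Vec Bool (suc m)) t) →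
                     V.map (select true (false ∷ r)) xs ≡ V.map (select true r) (V.map V.tail xs)
  select-skip-true [] = refl
  select-skip-true ((a ∷ x) ∷ xs) = cong (select true r x ∷_) (select-skip-true xs)

  select-skip-false : ∀ {t} (xs : Vec (Vec Bool (suc m)) t) →
                      V.map (select false (true ∷ r)) xs ≡ V.map (select false r) (V.map V.tail xs)
  select-skip-false [] = refl
  select-skip-false ((a ∷ x) ∷ xs) = cong (select false r x ∷_) (select-skip-false xs)

atomSize-select : ∀ {m t} (S : Vec Bool m) (xs : Vec (Vec Bool m) t) b s →
                  atomSize (S ∷ xs) (b ∷ s) ≡ atomSize (V.map (select b S) xs) s
atomSize-select [] xs b s = refl
atomSize-select (true ∷ r) xs true s
  rewrite atomSize-suc ((true ∷ r) ∷ xs) (true ∷ s) | atomSize-suc (V.map (select true (true ∷ r)) xs) s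
        | inAtom-zero-select-true r xs s | tail-select-true r xs
        | atomSize-select r (V.map V.tail xs) true s = refl
atomSize-select (false ∷ r) xs false s
  rewrite atomSize-suc ((false ∷ r) ∷ xs) (false ∷ s) | atomSize-suc (V.map (select false (false ∷ r)) xs) s
        | inAtom-zero-select-false r xs s | tail-select-false r xs
        | atomSize-select r (V.map V.tail xs) false s = refl
atomSize-select (false ∷ r) xs true s
  rewrite atomSize-suc ((false ∷ r) ∷ xs) (true ∷ s) | select-skip-true r xs = atomSize-select r (V.map V.tail xs) true s
atomSize-select (true ∷ r) xs false s
  rewrite atomSize-suc ((true ∷ r) ∷ xs) (false ∷ s) | select-skip-false r xs = atomSize-select r (V.map V.tail xs) false s

-- Distance classes

cancel-complements : ∀ {a b c d a′ c′ p} → a + b ≡ c + d → a′ + b ≡ c′ + d → a′ + a ≡ p → c′ + c ≡ p → a ≡ c × b ≡ d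
cancel-complements {a} {b} {c} {d} {a′} {c′} {p} ab≡cd a′b≡c′d a′a≡p c′c≡p =
  +-cancelʳ-≡ b a c (trans ab≡cd (cong (c +_) (sym b≡d))) , b≡d
  where
  open ≡-Reasoning
  regroup : ∀ a b a′ → (a + b) + (a′ + b) ≡ (a′ + a) + (b + b)
  regroup = solve-∀
  b+b≡d+d : b + b ≡ d + d
  b+b≡d+d = +-cancelˡ-≡ p _ _ (begin
    p + (b + b)               ≡⟨ cong (_+ (b + b)) a′a≡p ⟨
    (a′ + a) + (b + b)        ≡⟨ regroup a b a′ ⟨
    (a + b) + (a′ + b)        ≡⟨ cong₂ _+_ ab≡cd a′b≡c′d ⟩
    (c + d) + (c′ + d)        ≡⟨ regroup c d c′ ⟩
    (c′ + c) + (d + d)        ≡⟨ cong (_+ (d + d)) c′c≡p ⟩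
    p + (d + d)               ∎)
  b≡d : b ≡ d
  b≡d = trans (n≡⌊n+n/2⌋ b) (trans (cong ⌊_/2⌋ b+b≡d+d) (sym (n≡⌊n+n/2⌋ d)))

weight-⊕-complement : ∀ {k} (u v : Vec Bool k) → weight (u ⊕ (replicate k true ⊕ v)) + weight (u ⊕ v) ≡ k
weight-⊕-complement [] [] = refl
weight-⊕-complement (true  ∷ u) (true  ∷ v) = cong suc (weight-⊕-complement u v)
weight-⊕-complement (true  ∷ u) (false ∷ v) = trans (+-suc _ _) (cong suc (weight-⊕-complement u v))
weight-⊕-complement (false ∷ u) (true  ∷ v) = trans (+-suc _ _) (cong suc (weight-⊕-complement u v))
weight-⊕-complement (false ∷ u) (false ∷ v) = cong suc (weight-⊕-complement u v)

weight-⊕-select : ∀ {m} (S v z : Vec Bool m) →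
  weight (v ⊕ z) ≡ weight (select true S v ⊕ select true S z) + weight (select false S v ⊕ select false S z)
weight-⊕-select S v z = trans (weight-select S (v ⊕ z))
  (cong₂ _+_ (cong weight (select-zipWith _xor_ true S v z)) (cong weight (select-zipWith _xor_ false S v z)))

SameProfile : ∀ {m t} → Vec (Vec Bool m) t → Vec Bool m → Vec Bool m → Set
SameProfile xs x y = ∀ c → weight (x ⊕ lin xs c) ≡ weight (y ⊕ lin xs c)

sameProfile-select : ∀ {m t} (S : Vec Bool m) (xs : Vec (Vec Bool m) t) {x y : Vec Bool m} →
  SameProfile (S ∷ xs) x y → ∀ b → SameProfile (V.map (select b S) xs) (select b S x) (select b S y)
sameProfile-select {m} S xs {x} {y} same b c = begin
  weight (select b S x ⊕ lin (V.map (select b S) xs) c) ≡⟨ cong (λ w → weight (select b S x ⊕ w)) (select-lin b S xs c) ⟩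
  part b x                                              ≡⟨ parts-agree b ⟩
  part b y                                              ≡⟨ cong (λ w → weight (select b S y ⊕ w)) (select-lin b S xs c) ⟨
  weight (select b S y ⊕ lin (V.map (select b S) xs) c) ∎
  where
  open ≡-Reasoning
  z : Vec Bool m
  z = lin xs c
  part : Bool → Vec Bool m → ℕ
  part b v = weight (select b S v ⊕ select b S z)
  flipped : Vec Bool m → ℕ
  flipped v = weight (select true S v ⊕ (replicate _ true ⊕ select true S z))
  at-z : ∀ v → weight (v ⊕ (replicate m false ⊕ z)) ≡ part true v + part false v
  at-z v = trans (cong (λ w → weight (v ⊕ w)) (zipWith-identityˡ xor-identityˡ z)) (weight-⊕-select S v z)
  at-S⊕z : ∀ v → weight (v ⊕ (S ⊕ z)) ≡ flipped v + part false v
  at-S⊕z v = trans (weight-⊕-select S v (S ⊕ z)) (cong₂ (λ w w′ → weight (select true S v ⊕ w) + weight (select false S v ⊕ w′))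
    (trans (select-zipWith _xor_ true S S z) (cong (_⊕ select true S z) (select-self true S)))
    (trans (select-zipWith _xor_ false S S z)
           (trans (cong (_⊕ select false S z) (select-self false S)) (zipWith-identityˡ xor-identityˡ _))))
  agree : part true x ≡ part true y × part false x ≡ part false y
  agree = cancel-complements (trans (sym (at-z x)) (trans (same (false ∷ c)) (at-z y)))
                             (trans (sym (at-S⊕z x)) (trans (same (true ∷ c)) (at-S⊕z y)))
                             (weight-⊕-complement (select true S x) (select true S z))
                             (weight-⊕-complement (select true S y) (select true S z))
  parts-agree : ∀ b → part b x ≡ part b y
  parts-agree true  = proj₁ agree
  parts-agree false = proj₂ agree

T-allWeightsMatch : ∀ {m t} (xs : Vec (Vec Bool m) t) (nz : Vec Bool m → ℤ) (x : Vec Bool m) →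
  T (allWeightsMatch xs nz x) ⇔ (∀ c → ℤ.+ weight (x ⊕ lin xs c) ≡ nz (lin xs c))
T-allWeightsMatch xs nz x =
  mk⇔ (λ h c → toWitness (Equivalence.to (T-all-allVecs _) h c))
      (λ h → Equivalence.from (T-all-allVecs _) (λ c → fromWitness (h c)))

distancesFrom : ∀ {m} → Vec Bool m → Vec Bool m → ℤ
distancesFrom y z = ℤ.+ weight (y ⊕ z)

T-sameProfile : ∀ {m t} (xs : Vec (Vec Bool m) t) (y x : Vec Bool m) →
                T (allWeightsMatch xs (distancesFrom y) x) ⇔ SameProfile xs x y
T-sameProfile xs y x =
  mk⇔ (λ h c → +-injective (Equivalence.to (T-allWeightsMatch xs (distancesFrom y) x) h c))
      (λ h → Equivalence.from (T-allWeightsMatch xs (distancesFrom y) x) (λ c → cong ℤ.+_ (h c)))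

profileClass : ∀ {m t} → Vec (Vec Bool m) t → Vec Bool m → ℕ
profileClass {m} xs y = count (allWeightsMatch xs (distancesFrom y)) (allVecs m)

eventCount≤profileClass : ∀ {m t} (xs : Vec (Vec Bool m) t) (nz : Vec Bool m → ℤ) →
                          ∃ λ y → eventCount xs nz ≤ profileClass xs y
eventCount≤profileClass {m} xs nz with count≡0⊎satisfiable (allWeightsMatch xs nz) (allVecs m)
... | inj₁ empty = replicate m false , ≤-trans (≤-reflexive (trans (length-filterᵇ _ (allVecs m)) empty)) z≤n
... | inj₂ (y , event-y) = y , ≤-trans (≤-reflexive (length-filterᵇ (allWeightsMatch xs nz) (allVecs m)))
  (count-mono _ _ (allVecs m) λ x event-x → Equivalence.from (T-allWeightsMatch xs (distancesFrom y) x)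
    (λ c → trans (Equivalence.to (T-allWeightsMatch xs nz x) event-x c)
                 (sym (Equivalence.to (T-allWeightsMatch xs nz y) event-y c))))

^-2^suc : ∀ x t → x ^ (2 ^ suc t) ≡ x ^ (2 ^ t) * x ^ (2 ^ t)
^-2^suc x t = trans (cong (x ^_) (cong (2 ^ t +_) (+-identityʳ (2 ^ t)))) (^-distribˡ-+-* x (2 ^ t) (2 ^ t))

profileClass-restrict : ∀ {m t} (S : Vec Bool m) (xs : Vec (Vec Bool m) t) (y : Vec Bool m) →
  profileClass (S ∷ xs) y ≤ profileClass (V.map (select true S) xs) (select true S y) * profileClass (V.map (select false S) xs) (select false S y)
profileClass-restrict {m} S xs y = begin
  profileClass (S ∷ xs) y
    ≤⟨ count-mono _ _ (allVecs m) (λ x → both x ∘ Equivalence.to (T-sameProfile (S ∷ xs) y x)) ⟩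
  count (λ x → class true (select true S x) ∧ class false (select false S x)) (allVecs m)
    ≡⟨ count-select S (class true) (class false) ⟩
  profileClass (V.map (select true S) xs) (select true S y) * profileClass (V.map (select false S) xs) (select false S y) ∎
  where
  open ≤-Reasoning
  class : (b : Bool) → Vec Bool (occ b S) → Bool
  class b = allWeightsMatch (V.map (select b S) xs) (distancesFrom (select b S y))
  restricted : ∀ {x} → SameProfile (S ∷ xs) x y → ∀ b → T (class b (select b S x))
  restricted {x} same b = Equivalence.from (T-sameProfile (V.map (select b S) xs) (select b S y) (select b S x)) (sameProfile-select S xs same b)
  both : ∀ x → SameProfile (S ∷ xs) x y → T (class true (select true S x) ∧ class false (select false S x))
  both x same = Equivalence.from T-∧ (restricted same true , restricted same false)

profileClass-bound : ∀ {m t} (xs : Vec (Vec Bool m) t) (y : Vec Bool m) {n K : ℕ} →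
  (∀ s → n ≤ atomSize xs s * K) → profileClass xs y * profileClass xs y * n ^ (2 ^ t) ≤ K ^ (2 ^ t) * 4 ^ m
profileClass-bound {m} [] y {n} {K} large = begin
  N * N * n ^ 1      ≡⟨ cong (N * N *_) (*-identityʳ n) ⟩
  N * N * n          ≤⟨ *-mono-≤ (*-mono-≤ N≤B N≤B) (subst (λ a → n ≤ a * K) (atomSize-[] m) (large [])) ⟩
  B * B * (m * K)    ≡⟨ regroup₂ B m K ⟩
  K * (B * B * m)    ≤⟨ *-monoʳ-≤ K (mCk²*m≤4^m m (weight y)) ⟩
  K * 4 ^ m          ≡⟨ cong (_* 4 ^ m) (*-identityʳ K) ⟨
  K ^ 1 * 4 ^ m      ∎
  where
  open ≤-Reasoning
  N B : ℕ
  N = profileClass [] y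
  B = m C weight y
  same-weight : ∀ x → T (allWeightsMatch [] (distancesFrom y) x) → T (weight x ≡ᵇ weight y)
  same-weight x hx = ≡⇒≡ᵇ _ _ (begin-equality
    weight x                         ≡⟨ cong weight (zipWith-identityʳ xor-identityʳ x) ⟨
    weight (x ⊕ replicate m false)   ≡⟨ Equivalence.to (T-sameProfile [] y x) hx [] ⟩
    weight (y ⊕ replicate m false)   ≡⟨ cong weight (zipWith-identityʳ xor-identityʳ y) ⟩
    weight y                         ∎)
  N≤B : N ≤ B
  N≤B = ≤-trans (count-mono _ _ (allVecs m) same-weight) (≤-reflexive (count-weight m (weight y)))
  regroup₂ : ∀ B m K → B * B * (m * K) ≡ K * (B * B * m)
  regroup₂ = solve-∀
profileClass-bound {m} {suc t} (S ∷ xs) y {n} {K} large = begin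
  N * N * n ^ (2 ^ suc t)
    ≤⟨ *-mono-≤ (*-mono-≤ N≤N₁N₀ N≤N₁N₀) (≤-reflexive (^-2^suc n t)) ⟩
  (N₁ * N₀) * (N₁ * N₀) * (n ^ a * n ^ a)
    ≡⟨ regroup₁ N₁ N₀ (n ^ a) ⟩
  (N₁ * N₁ * n ^ a) * (N₀ * N₀ * n ^ a)
    ≤⟨ *-mono-≤ (profileClass-bound (V.map (select true S) xs) (select true S y) (restricted true))
                (profileClass-bound (V.map (select false S) xs) (select false S y) (restricted false)) ⟩
  (K ^ a * 4 ^ occ true S) * (K ^ a * 4 ^ occ false S)
    ≡⟨ regroup₂ (K ^ a) (4 ^ occ true S) (4 ^ occ false S) ⟩
  (K ^ a * K ^ a) * (4 ^ occ true S * 4 ^ occ false S)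
    ≡⟨ cong₂ _*_ (^-2^suc K t) (trans (cong (4 ^_) (sym (occ-true+occ-false S))) (^-distribˡ-+-* 4 (occ true S) (occ false S))) ⟨
  K ^ (2 ^ suc t) * 4 ^ m ∎
  where
  open ≤-Reasoning
  a N N₁ N₀ : ℕ
  a  = 2 ^ t
  N  = profileClass (S ∷ xs) y
  N₁ = profileClass (V.map (select true S) xs) (select true S y)
  N₀ = profileClass (V.map (select false S) xs) (select false S y)
  restricted : ∀ b s → n ≤ atomSize (V.map (select b S) xs) s * K
  restricted b s = subst (λ k → n ≤ k * K) (atomSize-select S xs b s) (large (b ∷ s))
  N≤N₁N₀ : N ≤ N₁ * N₀
  N≤N₁N₀ = profileClass-restrict S xs y
  regroup₁ : ∀ A B x → (A * B) * (A * B) * (x * x) ≡ (A * A * x) * (B * B * x)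
  regroup₁ = solve-∀
  regroup₂ : ∀ k p q → (k * p) * (k * q) ≡ (k * k) * (p * q)
  regroup₂ = solve-∀

4^m≡[2^m]^2 : ∀ m → 4 ^ m ≡ (2 ^ m) ^ 2
4^m≡[2^m]^2 m = trans (^-*-assoc 2 2 m) (trans (cong (2 ^_) (*-comm 2 m)) (sym (^-*-assoc 2 m 2)))

-- The probability bound, squared and cleared of denominators.
lemma3p2 : (t : ℕ) → ∃ λ (C : ℕ) →
    (n : ℕ) (xs : Vec (Vec Bool (2 * n)) t) →
    ((s : Vec Bool t) → n ≤ atomSize xs s * 2 ^ suc t) →
    (nz : Vec Bool (2 * n) → ℤ) →
    eventCount xs nz ^ 2 * n ^ (2 ^ t) ≤ C * (2 ^ (2 * n)) ^ 2
lemma3p2 t = K ^ (2 ^ t) , λ n xs large nz →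
  let (y , E≤N) = eventCount≤profileClass xs nz in begin
    eventCount xs nz ^ 2 * n ^ (2 ^ t)
      ≤⟨ *-monoˡ-≤ (n ^ (2 ^ t)) (^-monoˡ-≤ 2 E≤N) ⟩
    profileClass xs y ^ 2 * n ^ (2 ^ t)
      ≡⟨ cong (λ k → profileClass xs y * k * n ^ (2 ^ t)) (*-identityʳ (profileClass xs y)) ⟩
    profileClass xs y * profileClass xs y * n ^ (2 ^ t)
      ≤⟨ profileClass-bound xs y large ⟩
    K ^ (2 ^ t) * 4 ^ (2 * n)
      ≡⟨ cong (K ^ (2 ^ t) *_) (4^m≡[2^m]^2 (2 * n)) ⟩
    K ^ (2 ^ t) * (2 ^ (2 * n)) ^ 2 ∎
  where
  open ≤-Reasoning
  K : ℕ
  K = 2 ^ suc t
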